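{- Let $M$ be a strongly $\beta$-normalizable $\lambda$-term. Then $M$ is strongly normalizable for $\to^{\neg e}_\epsilon$, i.e. there is no infinite $\to^{\neg e}_\epsilon$-reduction sequence starting from $M$.
   Context: $\to^{\neg e}$ is the contextual closure of $(\lambda x.M)N\to M[N/x]$ when $x\in FV(M)$; $\to_\sigma$ is the contextual closure of $((\lambda x.M)N)P\to(\lambda x.MP)N$ when $x\notin FV(P)$; $\to^{\neg e}_\epsilon=\to^{\neg e}\cup\to_\sigma$. -}

module Defs where

open import Data.Nat using (ℕ; zero; suc; _+_; _<ᵇ_; compare; less; equal; greater)
open import Data.Bool using (if_then_else_)
open import Data.Product using (Σ; _×_)
open import Induction.WellFounded using (Acc)
open import Relation.Binary.PropositionalEquality using (_≡_)

data Term : Set where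
  var : ℕ → Term
  lam : Term → Term
  app : Term → Term → Term

shift : ℕ → Term → Term
shift c (var n)   = if n <ᵇ c then var n else var (suc n)
shift c (lam t)   = lam (shift (suc c) t)
shift c (app t u) = app (shift c t) (shift c u)

-- subst k N t : t[N/k], removing index k (free indices > k decremented)
-- substVar k N n : the variable n with N substituted for index k
-- (n < k unchanged, n = k ↦ N, n > k decremented)
substVar : ℕ → Term → ℕ → Term
substVar k N n with compare n k
... | less _ _    = var n
... | equal _     = N
... | greater _ m = var (k + m)
subst : ℕ → Term → Term → Term
subst k N (var n)   = substVar k N n
subst k N (lam t)   = lam (subst (suc k) (shift 0 N) t)
subst k N (app t u) = app (subst k N t) (subst k N u)

_[_] : Term → Term → Term
M [ N ] = subst 0 N M

data Free : ℕ → Term → Set where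
  fvar  : ∀ {k} → Free k (var k)
  flam  : ∀ {k t} → Free (suc k) t → Free k (lam t)
  fappl : ∀ {k t u} → Free k t → Free k (app t u)
  fappr : ∀ {k t u} → Free k u → Free k (app t u)

data _→β_ : Term → Term → Set where
  β    : ∀ {M N} → app (lam M) N →β (M [ N ])
  ξlam : ∀ {M M'} → M →β M' → lam M →β lam M'
  ξl   : ∀ {M M' N} → M →β M' → app M N →β app M' N
  ξr   : ∀ {M N N'} → N →β N' → app M N →β app M N'

-- →^{¬e}_ε = non-erasing β (x ∈ FV(M)) ∪ σ, contextually closed.
-- σ : ((λx.M)N)P → (λx.MP)N with x ∉ FV(P); in de Bruijn form P is
-- shifted under the binder, so x ∉ FV(P) holds by construction.
data _→ε_ : Term → Term → Set where
  βne  : ∀ {M N} → Free 0 M → app (lam M) N →ε (M [ N ])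
  σ    : ∀ {M N P} → app (app (lam M) N) P →ε app (lam (app M (shift 0 P))) N
  ξlam : ∀ {M M'} → M →ε M' → lam M →ε lam M'
  ξl   : ∀ {M M' N} → M →ε M' → app M N →ε app M' N
  ξr   : ∀ {M N N'} → N →ε N' → app M N →ε app M N'

flipβ : Term → Term → Set
flipβ N M = M →β N

SNβ : Term → Set
SNβ M = Acc flipβ M

InfiniteSeq : (Term → Term → Set) → Term → Set
InfiniteSeq R M = Σ (ℕ → Term) λ f → (f 0 ≡ M) × (∀ i → R (f i) (f (suc i)))

module Submission where

-- The core is the redex lemma:
-- a head redex (λK)N applied to a spine of arguments is SNε whenever N and
-- the contractum K[N] applied to the spine are.  It is proved by
-- lexicographic induction on SNε N, SNε of the contractum and the spine
-- length, since σ-steps shorten the spine without changing the contractum.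
-- Together with the easy case of variable-headed applications this gives
-- the application lemma: app t u is SNε when t, u and all β-reducts of
-- app t u are.  Induction on SNβ M, and inside on subterms, then shows that
-- every subterm of an SNβ term is SNε, and an SNε term starts no infinite
-- reduction sequence.

open import Defs
open import Data.Nat using (zero; suc; _<ᵇ_; compare; less; equal; greater; _≤_; _<_; z≤n; s≤s; z<s)
open import Data.Nat.Properties
  using (≤-trans; <-irrefl; <⇒≱; m≤m+n; m≤n⇒m≤1+n; m<n⇒m<1+n; <-≤-connex; <-cmp; m<m+n)
open import Data.Nat.Induction using (<-wellFounded)
open import Data.Bool using (true; false)
open import Data.List using (List; []; _∷_; _∷ʳ_; foldr; length)
open import Data.List.Properties using (foldr-∷ʳ; length-++)
open import Data.Product using (Σ; _×_; _,_)
open import Data.Sum using (inj₁; inj₂)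
open import Data.Empty using (⊥; ⊥-elim)
open import Function using (flip; _∘_)
open import Induction.WellFounded using (Acc; acc; module Subrelation)
open import Relation.Nullary using (¬_)
open import Relation.Binary using (tri<; tri≈; tri>)
import Relation.Binary.Construct.On as On
open import Relation.Binary.Construct.Closure.ReflexiveTransitive using (Star; ε; _◅_; _◅◅_; gmap)
open import Relation.Binary.PropositionalEquality using (_≡_; refl; sym; trans; cong; cong₂)
  renaming (subst to transport)
open Relation.Binary.PropositionalEquality.≡-Reasoning

<ᵇ-true : ∀ {n c} → n < c → (n <ᵇ c) ≡ true
<ᵇ-true {zero}  (s≤s _)   = refl
<ᵇ-true {suc n} (s≤s n<c) = <ᵇ-true n<c

<ᵇ-false : ∀ {n c} → c ≤ n → (n <ᵇ c) ≡ false
<ᵇ-false z≤n       = refl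
<ᵇ-false (s≤s c≤n) = <ᵇ-false c≤n

shift-var-< : ∀ {n c} → n < c → shift c (var n) ≡ var n
shift-var-< n<c rewrite <ᵇ-true n<c = refl

shift-var-≥ : ∀ {n c} → c ≤ n → shift c (var n) ≡ var (suc n)
shift-var-≥ c≤n rewrite <ᵇ-false c≤n = refl

subst-var-< : ∀ {n k N} → n < k → subst k N (var n) ≡ var n
subst-var-< {n} {k} n<k with compare n k
... | less _ _    = refl
... | equal _     = ⊥-elim (<-irrefl refl n<k)
... | greater _ m = ⊥-elim (<⇒≱ n<k (m≤n⇒m≤1+n (m≤m+n k m)))

subst-var-≡ : ∀ {n k N} → n ≡ k → subst k N (var n) ≡ N
subst-var-≡ {n} {k} n≡k with compare n k
... | less _ m    = ⊥-elim (<-irrefl n≡k (s≤s (m≤m+n n m)))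
... | equal _     = refl
... | greater _ m = ⊥-elim (<-irrefl (sym n≡k) (s≤s (m≤m+n k m)))

subst-var-> : ∀ {m k N} → k ≤ m → subst k N (var (suc m)) ≡ var m
subst-var-> {m} {k} k≤m with compare (suc m) k
... | less _ l    = ⊥-elim (<⇒≱ (s≤s k≤m) (m≤n⇒m≤1+n (m≤m+n (suc m) l)))
... | equal _     = ⊥-elim (<-irrefl refl (s≤s k≤m))
... | greater _ _ = refl

shift-shift : ∀ d c t → d ≤ c → shift (suc c) (shift d t) ≡ shift d (shift c t)
shift-shift d c (var n) d≤c with <-≤-connex n d
... | inj₁ n<d
  rewrite shift-var-< n<d | shift-var-< (≤-trans n<d d≤c) | shift-var-< n<d
  = shift-var-< (m<n⇒m<1+n (≤-trans n<d d≤c))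
... | inj₂ d≤n with <-≤-connex n c
...   | inj₁ n<c
  rewrite shift-var-≥ d≤n | shift-var-< n<c | shift-var-≥ d≤n
  = shift-var-< (s≤s n<c)
...   | inj₂ c≤n
  rewrite shift-var-≥ d≤n | shift-var-≥ c≤n | shift-var-≥ (m≤n⇒m≤1+n d≤n)
  = shift-var-≥ (s≤s c≤n)
shift-shift d c (lam t)   d≤c = cong lam (shift-shift (suc d) (suc c) t (s≤s d≤c))
shift-shift d c (app t u) d≤c = cong₂ app (shift-shift d c t d≤c) (shift-shift d c u d≤c)

shift-subst : ∀ k c N t → k ≤ c → shift c (subst k N t) ≡ subst k (shift c N) (shift (suc c) t)
shift-subst k c N (var n) k≤c with <-cmp n k
... | tri< n<k _ _
  rewrite subst-var-< {N = N} n<k | shift-var-< (≤-trans n<k k≤c)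
        | shift-var-< (≤-trans n<k (m≤n⇒m≤1+n k≤c)) | subst-var-< {N = shift c N} n<k
  = refl
... | tri≈ _ refl _
  rewrite subst-var-≡ {N = N} (refl {x = k}) | shift-var-< (s≤s k≤c)
        | subst-var-≡ {N = shift c N} (refl {x = k})
  = refl
... | tri> _ _ (s≤s {n = m} k≤m) with <-≤-connex m c
...   | inj₁ m<c
  rewrite subst-var-> {N = N} k≤m | shift-var-< m<c | shift-var-< (s≤s m<c)
        | subst-var-> {N = shift c N} k≤m
  = refl
...   | inj₂ c≤m
  rewrite subst-var-> {N = N} k≤m | shift-var-≥ c≤m | shift-var-≥ (s≤s c≤m)
        | subst-var-> {N = shift c N} (m≤n⇒m≤1+n k≤m)
  = refl
shift-subst k c N (lam t) k≤c =
  cong lam (trans (shift-subst (suc k) (suc c) (shift 0 N) t (s≤s k≤c))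
                  (cong (λ X → subst (suc k) X (shift (suc (suc c)) t)) (shift-shift 0 c N z≤n)))
shift-subst k c N (app t u) k≤c = cong₂ app (shift-subst k c N t k≤c) (shift-subst k c N u k≤c)

subst-shift-cancel : ∀ k N t → subst k N (shift k t) ≡ t
subst-shift-cancel k N (var n) with <-≤-connex n k
... | inj₁ n<k rewrite shift-var-< n<k = subst-var-< n<k
... | inj₂ k≤n rewrite shift-var-≥ k≤n = subst-var-> k≤n
subst-shift-cancel k N (lam t)   = cong lam (subst-shift-cancel (suc k) (shift 0 N) t)
subst-shift-cancel k N (app t u) = cong₂ app (subst-shift-cancel k N t) (subst-shift-cancel k N u)

subst-shift : ∀ c k N t → c ≤ k → subst (suc k) (shift c N) (shift c t) ≡ shift c (subst k N t)
subst-shift c k N (var n) c≤k with <-≤-connex n c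
... | inj₁ n<c
  rewrite shift-var-< n<c | subst-var-< {N = shift c N} (≤-trans n<c (m≤n⇒m≤1+n c≤k))
        | subst-var-< {N = N} (≤-trans n<c c≤k) | shift-var-< n<c
  = refl
... | inj₂ c≤n with <-cmp n k
...   | tri< n<k _ _
  rewrite shift-var-≥ c≤n | subst-var-< {N = shift c N} (s≤s n<k)
        | subst-var-< {N = N} n<k | shift-var-≥ c≤n
  = refl
...   | tri≈ _ refl _
  rewrite shift-var-≥ c≤n | subst-var-≡ {N = shift c N} (refl {x = suc k})
        | subst-var-≡ {N = N} (refl {x = k})
  = refl
...   | tri> _ _ (s≤s {n = m} k≤m)
  rewrite shift-var-≥ c≤n | subst-var-> {N = shift c N} (s≤s k≤m)
        | subst-var-> {N = N} k≤m | shift-var-≥ (≤-trans c≤k k≤m)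
  = refl
subst-shift c k N (lam t) c≤k =
  cong lam (trans (cong (λ X → subst (suc (suc k)) X (shift (suc c) t)) (sym (shift-shift 0 c N z≤n)))
                  (subst-shift (suc c) (suc k) (shift 0 N) t (s≤s c≤k)))
subst-shift c k N (app t u) c≤k = cong₂ app (subst-shift c k N t c≤k) (subst-shift c k N u c≤k)

subst-subst : ∀ j k N B t → j ≤ k →
  subst k N (subst j B t) ≡ subst j (subst k N B) (subst (suc k) (shift j N) t)
subst-subst j k N B (var n) j≤k with <-cmp n j
... | tri< n<j _ _
  rewrite subst-var-< {N = B} n<j | subst-var-< {N = N} (≤-trans n<j j≤k)
        | subst-var-< {N = shift j N} (≤-trans n<j (m≤n⇒m≤1+n j≤k))
        | subst-var-< {N = subst k N B} n<j
  = refl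
... | tri≈ _ refl _
  rewrite subst-var-≡ {N = B} (refl {x = j}) | subst-var-< {N = shift j N} (s≤s j≤k)
        | subst-var-≡ {N = subst k N B} (refl {x = j})
  = refl
... | tri> _ _ (s≤s {n = m} j≤m) with <-cmp m k
...   | tri< m<k _ _
  rewrite subst-var-> {N = B} j≤m | subst-var-< {N = N} m<k
        | subst-var-< {N = shift j N} (s≤s m<k) | subst-var-> {N = subst k N B} j≤m
  = refl
...   | tri≈ _ refl _
  rewrite subst-var-> {N = B} j≤m | subst-var-≡ {N = N} (refl {x = m})
        | subst-var-≡ {N = shift j N} (refl {x = suc m})
  = sym (subst-shift-cancel j (subst m N B) N)
...   | tri> _ _ (s≤s {n = l} k≤l)
  rewrite subst-var-> {N = B} j≤m | subst-var-> {N = N} k≤l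
        | subst-var-> {N = shift j N} (s≤s k≤l) | subst-var-> {N = subst k N B} (≤-trans j≤k k≤l)
  = refl
subst-subst j k N B (lam t) j≤k =
  cong lam (trans (subst-subst (suc j) (suc k) (shift 0 N) (shift 0 B) t (s≤s j≤k))
                  (cong₂ (λ X Y → subst (suc j) X (subst (suc (suc k)) Y t))
                         (subst-shift 0 k N B z≤n) (shift-shift 0 j N z≤n)))
subst-subst j k N B (app t u) j≤k = cong₂ app (subst-subst j k N B t j≤k) (subst-subst j k N B u j≤k)

free-shift : ∀ {i c t} → i < c → Free i t → Free i (shift c t)
free-shift i<c fvar rewrite shift-var-< i<c = fvar
free-shift i<c (flam f)  = flam (free-shift (s≤s i<c) f)
free-shift i<c (fappl f) = fappl (free-shift i<c f)
free-shift i<c (fappr f) = fappr (free-shift i<c f)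

free-subst : ∀ {i k N t} → i < k → Free i t → Free i (subst k N t)
free-subst {N = N} i<k fvar rewrite subst-var-< {N = N} i<k = fvar
free-subst i<k (flam f)  = flam (free-subst (s≤s i<k) f)
free-subst i<k (fappl f) = fappl (free-subst i<k f)
free-subst i<k (fappr f) = fappr (free-subst i<k f)

_→ε⟨_⟩ : ∀ {t u u'} → t →ε u → u ≡ u' → t →ε u'
s →ε⟨ refl ⟩ = s

shift-step : ∀ c {t t'} → t →ε t' → shift c t →ε shift c t'
shift-step c (βne {M} {N} f) = βne (free-shift (s≤s z≤n) f) →ε⟨ sym (shift-subst 0 c N M z≤n) ⟩
shift-step c (σ {M} {N} {P}) =
  σ →ε⟨ cong (λ X → app (lam (app (shift (suc c) M) X)) (shift c N)) (sym (shift-shift 0 c P z≤n)) ⟩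
shift-step c (ξlam s) = ξlam (shift-step (suc c) s)
shift-step c (ξl s)   = ξl (shift-step c s)
shift-step c (ξr s)   = ξr (shift-step c s)

subst-step : ∀ k N {t t'} → t →ε t' → subst k N t →ε subst k N t'
subst-step k N (βne {M} {B} f) = βne (free-subst (s≤s z≤n) f) →ε⟨ sym (subst-subst 0 k N B M z≤n) ⟩
subst-step k N (σ {M} {B} {P}) =
  σ →ε⟨ cong (λ X → app (lam (app (subst (suc k) (shift 0 N) M) X)) (subst k N B))
             (sym (subst-shift 0 k N P z≤n)) ⟩
subst-step k N (ξlam s) = ξlam (subst-step (suc k) (shift 0 N) s)
subst-step k N (ξl s)   = ξl (subst-step k N s)
subst-step k N (ξr s)   = ξr (subst-step k N s)

-- Reducing the substituted term gives a (possibly empty, possibly long)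
-- reduction of the result, one step per occurrence of the index.
subst-arg-steps : ∀ k t {N N'} → N →ε N' → Star _→ε_ (subst k N t) (subst k N' t)
subst-arg-steps k (var n) {N} {N'} s with <-cmp n k
... | tri< n<k _ _ rewrite subst-var-< {N = N} n<k | subst-var-< {N = N'} n<k = ε
... | tri≈ _ n≡k _ rewrite subst-var-≡ {N = N} n≡k | subst-var-≡ {N = N'} n≡k = s ◅ ε
... | tri> _ _ (s≤s k≤m) rewrite subst-var-> {N = N} k≤m | subst-var-> {N = N'} k≤m = ε
subst-arg-steps k (lam t)   s = gmap lam ξlam (subst-arg-steps (suc k) t (shift-step 0 s))
subst-arg-steps k (app t u) s =
  gmap (λ X → app X _) ξl (subst-arg-steps k t s) ◅◅ gmap (app _) ξr (subst-arg-steps k u s)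

SNε : Term → Set
SNε = Acc (flip _→ε_)

sn-steps : ∀ {t u} → SNε t → Star _→ε_ t u → SNε u
sn-steps sn        ε        = sn
sn-steps (acc rs) (s ◅ ss) = sn-steps (rs s) ss

sn-inverse : (f : Term → Term) → (∀ {x y} → x →ε y → f x →ε f y) → ∀ {x} → SNε (f x) → SNε x
sn-inverse f f-step = Subrelation.accessible f-step ∘ On.accessible f

sn-lam : ∀ {t} → SNε t → SNε (lam t)
sn-lam (acc rs) = acc λ { (ξlam s) → sn-lam (rs s) }

sn-no-infinite : ∀ {R : Term → Term → Set} {M} → Acc (flip R) M → ¬ InfiniteSeq R M
sn-no-infinite (acc rs) (f , refl , steps) =
  sn-no-infinite (rs (steps 0)) (f ∘ suc , refl , steps ∘ suc)

-- Spines: t · us applies t to the arguments us, listed outermost first,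
-- so that t · (u ∷ us) = app (t · us) u.
infixl 25 _·_
_·_ : Term → List Term → Term
t · us = foldr (flip app) t us

·-∷ʳ : ∀ t P us → t · (us ∷ʳ P) ≡ app t P · us
·-∷ʳ t P us = foldr-∷ʳ (flip app) t P us

-- A σ-step removes the innermost argument, shortening the spine.
length-<-∷ʳ : ∀ (us : List Term) P → length us < length (us ∷ʳ P)
length-<-∷ʳ us P = transport (length us <_) (sym (length-++ us)) (m<m+n (length us) z<s)

data _⇒ᵃ_ : List Term → List Term → Set where
  here  : ∀ {u u' us} → u →ε u' → (u ∷ us) ⇒ᵃ (u' ∷ us)
  there : ∀ {u us us'} → us ⇒ᵃ us' → (u ∷ us) ⇒ᵃ (u ∷ us')

length-⇒ᵃ : ∀ {us us'} → us ⇒ᵃ us' → length us ≡ length us'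
length-⇒ᵃ (here _)  = refl
length-⇒ᵃ (there d) = cong suc (length-⇒ᵃ d)

spine-step : ∀ t {us us'} → us ⇒ᵃ us' → t · us →ε t · us'
spine-step t (here s)  = ξr s
spine-step t (there d) = ξl (spine-step t d)

head-step : ∀ us {t t'} → t →ε t' → t · us →ε t' · us
head-step []       s = s
head-step (u ∷ us) s = ξl (head-step us s)

head-stepβ : ∀ us {t t'} → t →β t' → t · us →β t' · us
head-stepβ []       s = s
head-stepβ (u ∷ us) s = ξl (head-stepβ us s)

-- The one-step reducts of a head redex (λK)N applied to a spine us:
-- contracting it (the contraction is listed even when K erases), a step
-- inside K, N or the spine, or a σ-step moving the innermost argument P
-- under the binder.
data RedexReduct (K N : Term) (us : List Term) : Term → Set where
  contract : RedexReduct K N us ((K [ N ]) · us)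
  in-body  : ∀ {K'} → K →ε K' → RedexReduct K N us (app (lam K') N · us)
  in-arg   : ∀ {N'} → N →ε N' → RedexReduct K N us (app (lam K) N' · us)
  in-spine : ∀ {us'} → us ⇒ᵃ us' → RedexReduct K N us (app (lam K) N · us')
  permute  : ∀ P rest → us ≡ rest ∷ʳ P →
             RedexReduct K N us (app (lam (app K (shift 0 P))) N · rest)

extend : ∀ {K N us T u} → RedexReduct K N us T → RedexReduct K N (u ∷ us) (app T u)
extend contract           = contract
extend (in-body s)        = in-body s
extend (in-arg s)         = in-arg s
extend (in-spine d)       = in-spine (there d)
extend (permute P rest e) = permute P (_ ∷ rest) (cong (_ ∷_) e)

app-injectiveˡ : ∀ {t t' u u'} → app t u ≡ app t' u' → t ≡ t'
app-injectiveˡ refl = refl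

lam-not-redex-spine : ∀ {M K N} us → lam M ≡ app (lam K) N · us → ⊥
lam-not-redex-spine []       ()
lam-not-redex-spine (u ∷ us) ()

redex-reducts : ∀ {K N} us {S T} → S →ε T → S ≡ app (lam K) N · us → RedexReduct K N us T
redex-reducts []           (βne _)      refl = contract
redex-reducts []           (ξl (ξlam s)) refl = in-body s
redex-reducts []           (ξr s)       refl = in-arg s
redex-reducts (u ∷ us)     (βne _)      e    = ⊥-elim (lam-not-redex-spine us (app-injectiveˡ e))
redex-reducts (u ∷ [])     σ            refl = permute u [] refl
redex-reducts (u ∷ v ∷ us) σ            e    =
  ⊥-elim (lam-not-redex-spine us (app-injectiveˡ (app-injectiveˡ e)))
redex-reducts (u ∷ us)     (ξl s)       refl = extend (redex-reducts us s refl)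
redex-reducts (u ∷ us)     (ξr s)       refl = in-spine (here s)

-- A σ-step on the redex leaves its contractum unchanged, since the moved
-- argument was shifted past the binder that the contraction removes.
contractum-permute : ∀ K N P rest →
  (K [ N ]) · (rest ∷ʳ P) ≡ ((app K (shift 0 P)) [ N ]) · rest
contractum-permute K N P rest = begin
  (K [ N ]) · (rest ∷ʳ P)                      ≡⟨ ·-∷ʳ (K [ N ]) P rest ⟩
  app (K [ N ]) P · rest                       ≡⟨ cong (λ X → app (K [ N ]) X · rest)
                                                       (sym (subst-shift-cancel 0 N P)) ⟩
  app (K [ N ]) (subst 0 N (shift 0 P)) · rest ∎

-- The proof is by lexicographic induction on SNε N,
-- SNε of the contractum, and the length of the spine (σ-steps shorten it
-- without changing the contractum).  The contractum is passed as a
-- separate term B so that its accessibility proof stays syntactically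
-- unchanged across σ-steps.
mutual
  redex-sn : ∀ K N us → SNε N → (B : Term) → SNε B → B ≡ (K [ N ]) · us →
             Acc _<_ (length us) → SNε (app (lam K) N · us)
  redex-sn K N us snN B snB B≡ accL =
    acc λ s → reduct-sn K N us snN B snB B≡ accL (redex-reducts us s refl)

  reduct-sn : ∀ K N us → SNε N → (B : Term) → SNε B → B ≡ (K [ N ]) · us →
              Acc _<_ (length us) → ∀ {T} → RedexReduct K N us T → SNε T
  reduct-sn K N us snN B snB B≡ accL contract = transport SNε B≡ snB
  reduct-sn K N us snN B (acc rB) refl accL (in-body {K'} s) =
    redex-sn K' N us snN _ (rB (head-step us (subst-step 0 N s))) refl accL
  reduct-sn K N us (acc rN) B snB refl accL (in-arg {N'} s) =
    redex-sn K N' us (rN s) ((K [ N' ]) · us)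
             (sn-steps snB (gmap (_· us) (head-step us) (subst-arg-steps 0 K s))) refl accL
  reduct-sn K N us snN B (acc rB) refl accL (in-spine {us'} d) =
    redex-sn K N us' snN _ (rB (spine-step (K [ N ]) d)) refl
             (transport (Acc _<_) (length-⇒ᵃ d) accL)
  reduct-sn K N us snN B snB B≡ (acc rL) (permute P rest refl) =
    redex-sn (app K (shift 0 P)) N rest snN B snB (trans B≡ (contractum-permute K N P rest))
             (rL (length-<-∷ʳ rest P))

data Neutral : Term → Set where
  nvar : ∀ {n} → Neutral (var n)
  napp : ∀ {t u} → Neutral t → Neutral (app t u)

neutral-step : ∀ {t t'} → Neutral t → t →ε t' → Neutral t'
neutral-step (napp ())        (βne _)
neutral-step (napp (napp ())) σ
neutral-step (napp n)         (ξl s) = napp (neutral-step n s)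
neutral-step (napp n)         (ξr _) = napp n

-- An application with neutral function part reduces only inside its two
-- parts, so it is SNε when both parts are.
mutual
  neutral-app-sn : ∀ {t u} → Neutral t → SNε t → SNε u → SNε (app t u)
  neutral-app-sn n snt snu = acc (neutral-app-reduct-sn n snt snu)

  neutral-app-reduct-sn : ∀ {t u v} → Neutral t → SNε t → SNε u → app t u →ε v → SNε v
  neutral-app-reduct-sn ()         _        _        (βne _)
  neutral-app-reduct-sn (napp ())  _        _        σ
  neutral-app-reduct-sn n          (acc rt) snu      (ξl s) = neutral-app-sn (neutral-step n s) (rt s) snu
  neutral-app-reduct-sn n          snt      (acc ru) (ξr s) = neutral-app-sn n snt (ru s)

data HeadView : Term → Set where
  neutral : ∀ {t} → Neutral t → HeadView t
  abstr   : ∀ K → HeadView (lam K)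
  redex   : ∀ K N us → HeadView (app (lam K) N · us)

head-view : ∀ t → HeadView t
head-view (var n) = neutral nvar
head-view (lam K) = abstr K
head-view (app t u) with head-view t
... | neutral n    = neutral (napp n)
... | abstr K      = redex K u []
... | redex K N us = redex K N (u ∷ us)

-- The application lemma: app t u is SNε if t and u are and every β-reduct
-- of app t u is.
app-sn : ∀ t u → SNε t → SNε u → (∀ {v} → app t u →β v → SNε v) → SNε (app t u)
app-sn t u snt snu sn-reducts with head-view t
... | neutral n = neutral-app-sn n snt snu
... | abstr K   = redex-sn K u [] snu (K [ u ]) (sn-reducts β) refl (<-wellFounded 0)
... | redex K N us =
  redex-sn K N (u ∷ us) (sn-inverse (λ X → app (lam K) X · us) (head-step us ∘ ξr) snt)
           ((K [ N ]) · (u ∷ us)) (sn-reducts (ξl (head-stepβ us β))) refl (<-wellFounded _)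

data _⊑_ : Term → Term → Set where
  here  : ∀ {t} → t ⊑ t
  inlam : ∀ {s t} → s ⊑ t → s ⊑ lam t
  inl   : ∀ {s t u} → s ⊑ t → s ⊑ app t u
  inr   : ∀ {s t u} → s ⊑ u → s ⊑ app t u

⊑-trans : ∀ {s t M} → s ⊑ t → t ⊑ M → s ⊑ M
⊑-trans p here      = p
⊑-trans p (inlam q) = inlam (⊑-trans p q)
⊑-trans p (inl q)   = inl (⊑-trans p q)
⊑-trans p (inr q)   = inr (⊑-trans p q)

⊑-step : ∀ {s s' M} → s ⊑ M → s →β s' → Σ Term λ M' → (M →β M') × (s' ⊑ M')
⊑-step here      st = _ , st , here
⊑-step (inlam p) st with ⊑-step p st
... | M' , st' , p' = lam M' , ξlam st' , inlam p'
⊑-step (inl p)   st with ⊑-step p st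
... | M' , st' , p' = app M' _ , ξl st' , inl p'
⊑-step (inr p)   st with ⊑-step p st
... | M' , st' , p' = app _ M' , ξr st' , inr p'

-- Every subterm of an SNβ term is SNε, by induction on SNβ M and, inside,
-- on the subterm.  The application lemma reduces the β-reducts of a
-- subterm to subterms of β-reducts of M.
subterm-sn : ∀ M → SNβ M → ∀ s → s ⊑ M → SNε s
subterm-sn M snM (var n) p = acc λ ()
subterm-sn M snM (lam t) p = sn-lam (subterm-sn M snM t (⊑-trans (inlam here) p))
subterm-sn M snM@(acc rM) (app t u) p =
  app-sn t u (subterm-sn M snM t (⊑-trans (inl here) p))
             (subterm-sn M snM u (⊑-trans (inr here) p))
             (λ st → sn-of-lifted (⊑-step p st))
  where
  sn-of-lifted : ∀ {s'} → Σ Term (λ M' → (M →β M') × (s' ⊑ M')) → SNε s'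
  sn-of-lifted (M' , st' , p') = subterm-sn M' (rM st') _ p'

mainTheorem19 : (M : Term) → SNβ M → ¬ InfiniteSeq _→ε_ M
mainTheorem19 M snβ = sn-no-infinite (subterm-sn M snβ M here)
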